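{- Let $t\ge 2$ and $p\ge 0$ be integers, and let the edges of $K_n$ (with vertex set $V$) be colored with colors $1,\dots,t$. For $1\le i\le t$ let $G_i$ be the spanning subgraph of $K_n$ on $V$ consisting of all edges whose color is different from $i$. Suppose $X_1,\dots,X_t\subseteq V$ satisfy $|X_1|\le |X_2|\le\dots\le |X_t|$ and, for every $i$, $c_o(G_i - X_i)\ge |X_i|+p+2$. Let $C_1,\dots,C_{m}$ be the vertex sets of the connected components of $G_1 - X_1$ (the subgraph of $G_1$ induced on $V\setminus X_1$). Then there is an index $l\in\{1,\dots,m\}$ such that for every $j\in\{2,\dots,t\}$ we have $\bigcup_{i\ne l} C_i\subseteq X_j$.
   Context: For a graph $G$, $c_o(G)$ denotes the number of connected components of $G$ with an odd number of vertices. For $X\subseteq V(G)$, $G-X$ denotes the subgraph of $G$ induced on $V(G)\setminus X$. -}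

module Defs where

open import Data.Nat using (ℕ; zero; suc; _+_; _<ᵇ_)
open import Data.Fin using (Fin; toℕ) renaming (zero to fz; suc to fs)
open import Data.Fin.Properties using (_≟_)
open import Data.Fin.Subset using (Subset)
open import Data.Vec using (lookup)
open import Data.Bool using (Bool; true; false; _∧_; _∨_; not)
open import Relation.Nullary.Decidable using (⌊_⌋)

Graph : ℕ → Set
Graph n = Fin n → Fin n → Bool

anyV : ∀ {n} → (Fin n → Bool) → Bool
anyV {zero}  f = false
anyV {suc n} f = f fz ∨ anyV (λ i → f (fs i))

countV : ∀ {n} → (Fin n → Bool) → ℕ
countV {zero}  f = 0
countV {suc n} f = (if f fz then 1 else 0) + countV (λ i → f (fs i))
  where
  if_then_else_ : Bool → ℕ → ℕ → ℕ
  if true  then a else b = a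
  if false then a else b = b

oddᵇ : ℕ → Bool
oddᵇ zero    = false
oddᵇ (suc k) = not (oddᵇ k)

-- Edge colouring of K_n with t colours: c u v is the colour of edge uv
-- (for u ≢ v; the value on the diagonal is irrelevant).
colourComplement : ∀ {n t} → (Fin n → Fin n → Fin t) → Fin t → Graph n
colourComplement c i u v = not ⌊ u ≟ v ⌋ ∧ not ⌊ c u v ≟ i ⌋

-- G - X : the subgraph induced on V \ X (vertices of X are isolated and
-- are excluded from all vertex counts below).
deleteV : ∀ {n} → Graph n → Subset n → Graph n
deleteV G X u v = not (lookup X u) ∧ not (lookup X v) ∧ G u v

reachIn : ∀ {n} → ℕ → Graph n → Fin n → Fin n → Bool
reachIn zero    G u v = ⌊ u ≟ v ⌋
reachIn (suc k) G u v = reachIn k G u v ∨ anyV (λ w → reachIn k G u w ∧ G w v)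

-- Connectivity: u and v lie in the same connected component
-- (walks of length ≤ n suffice in a graph with n vertices).
connected : ∀ {n} → Graph n → Fin n → Fin n → Bool
connected {n} G = reachIn n G

inComponent : ∀ {n} → Graph n → Subset n → Fin n → Fin n → Bool
inComponent G X v w = not (lookup X w) ∧ connected (deleteV G X) v w

componentSize : ∀ {n} → Graph n → Subset n → Fin n → ℕ
componentSize G X v = countV (inComponent G X v)

-- v is the least vertex of its component of G - X (one representative per
-- component).
isRepresentative : ∀ {n} → Graph n → Subset n → Fin n → Bool
isRepresentative G X v =
  not (lookup X v) ∧ not (anyV (λ w → (toℕ w <ᵇ toℕ v) ∧ inComponent G X v w))

oddComponents : ∀ {n} → Graph n → Subset n → ℕ
oddComponents G X =
  countV (λ v → isRepresentative G X v ∧ oddᵇ (componentSize G X v))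

module Submission where

-- An edge of K_n
-- between different components of G₀ − X₀ has colour 0, so it is an edge of
-- every Gⱼ with j ≠ 0.  Three steps:
--  (1) Forcing: if j ≠ 0 and u ∉ X₀ ∪ Xⱼ, every v ∉ X₀ outside the component of
--      u lies in Xⱼ; otherwise all vertices outside X₀ ∪ Xⱼ are joined through u
--      or v in Gⱼ − Xⱼ, which then has at most 1 + |X₀| ≤ 1 + |Xⱼ| components.
--  (2) No crossing: u ∉ X₀ ∪ Xⱼ and w ∉ X₀ ∪ Xₖ (j, k ≠ 0) lie in the same
--      component: else (1) and c_o(G₀ − X₀) ≥ |X₀| + p + 2 give
--      n + p ≤ |Xⱼ| + |Xₖ|, while c_o(Gⱼ − Xⱼ) ≤ n − |Xⱼ| gives 2|Xⱼ| + p + 2 ≤ n.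
--  (3) If some u ∉ X₀ misses some Xⱼ (j ≠ 0), l = u works by (1) and (2);
--      otherwise all Xⱼ contain every vertex outside X₀ and any l ∉ X₀ works.

open import Defs
open import Data.Nat using (ℕ; _+_; _≤_)
open import Data.Fin using (Fin; zero)
open import Data.Fin.Subset using (Subset; _∈_; _∉_; ∣_∣)
open import Data.Bool using (false)
open import Data.Product using (Σ; _×_)
open import Relation.Binary.PropositionalEquality using (_≡_; _≢_)
import Data.Fin as F

open import Algebra.Properties.CommutativeSemigroup using (interchange)
open import Data.Bool using (Bool; true; _∧_; _∨_; not)
open import Data.Bool.Properties using (T-≡) renaming (_≟_ to _≟ᵇ_)
open import Data.Empty using (⊥; ⊥-elim)
open import Data.Fin using (toℕ) renaming (suc to fsuc)
open import Data.Fin.Properties using (_≟_; toℕ-injective; suc-injective; 0≢1+n; any?)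
open import Data.Nat using (suc; _<_; _<ᵇ_; z≤n; s≤s; s≤s⁻¹)
open import Data.Nat.Properties
  using (≤-refl; ≤-trans; ≤-total; <⇒≱; <-cmp; <⇒<ᵇ; +-mono-≤;
         +-monoˡ-≤; +-monoʳ-≤; +-comm; +-assoc; +-suc; +-identityʳ; m≤m+n; m≤n+m;
         m+1+n≰m; +-commutativeSemigroup; module ≤-Reasoning)
open import Data.Nat.Tactic.RingSolver using (solve-∀)
open import Data.Product using (_,_; ∃)
open import Data.Sum using (_⊎_; inj₁; inj₂)
open import Data.Vec using ([]; _∷_; lookup)
open import Data.Vec.Properties using ([]=⇒lookup; lookup⇒[]=)
open import Function.Bundles using (Equivalence)
open import Relation.Binary using (tri<; tri≈; tri>)
open import Relation.Binary.PropositionalEquality using (refl; sym; trans; cong; cong₂; subst; module ≡-Reasoning)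
open import Relation.Nullary using (yes; no; ¬_)
open import Relation.Nullary.Decidable using (Dec; ⌊_⌋; isYes≗does; dec-true; dec-false; ¬?; _×-dec_)

∧-elimˡ : ∀ {a b} → a ∧ b ≡ true → a ≡ true
∧-elimˡ {true}  _  = refl
∧-elimˡ {false} ()

∧-elimʳ : ∀ {a b} → a ∧ b ≡ true → b ≡ true
∧-elimʳ {true}  eq = eq
∧-elimʳ {false} ()

∧-intro : ∀ {a b} → a ≡ true → b ≡ true → a ∧ b ≡ true
∧-intro refl refl = refl

∨-elim : ∀ {a b} → a ∨ b ≡ true → a ≡ true ⊎ b ≡ true
∨-elim {true}  _  = inj₁ refl
∨-elim {false} eq = inj₂ eq

∨-introˡ : ∀ {a b} → a ≡ true → a ∨ b ≡ true
∨-introˡ refl = refl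

∨-introʳ : ∀ {a b} → b ≡ true → a ∨ b ≡ true
∨-introʳ {true}  _  = refl
∨-introʳ {false} eq = eq

not-true : ∀ {a} → not a ≡ true → a ≡ false
not-true {false} _ = refl
not-true {true}  ()

not-false : ∀ {a} → a ≡ false → not a ≡ true
not-false refl = refl

true≢false : ∀ {a} → a ≡ true → a ≡ false → ⊥
true≢false refl ()

¬false⇒true : ∀ {a} → ¬ (a ≡ false) → a ≡ true
¬false⇒true {true}  _  = refl
¬false⇒true {false} ne = ⊥-elim (ne refl)

¬true⇒false : ∀ {a} → ¬ (a ≡ true) → a ≡ false
¬true⇒false {false} _  = refl
¬true⇒false {true}  ne = ⊥-elim (ne refl)

true-or-false : (a : Bool) → a ≡ true ⊎ a ≡ false
true-or-false true  = inj₁ refl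
true-or-false false = inj₂ refl

⌊⌋-true : ∀ {P : Set} (d : Dec P) → P → ⌊ d ⌋ ≡ true
⌊⌋-true d p = trans (isYes≗does d) (dec-true d p)

⌊⌋-false : ∀ {P : Set} (d : Dec P) → ¬ P → ⌊ d ⌋ ≡ false
⌊⌋-false d ¬p = trans (isYes≗does d) (dec-false d ¬p)

_⊆_ : ∀ {n} → (Fin n → Bool) → (Fin n → Bool) → Set
f ⊆ g = ∀ v → f v ≡ true → g v ≡ true

⟦_⟧ : Bool → ℕ
⟦ true  ⟧ = 1
⟦ false ⟧ = 0

⟦⟧-mono : ∀ {a b} → (a ≡ true → b ≡ true) → ⟦ a ⟧ ≤ ⟦ b ⟧
⟦⟧-mono {false} _   = z≤n
⟦⟧-mono {true}  a⇒b rewrite a⇒b refl = ≤-refl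

countV-suc : ∀ {n} (f : Fin (suc n) → Bool) →
             countV f ≡ ⟦ f zero ⟧ + countV (λ i → f (fsuc i))
countV-suc f with f zero
... | true  = refl
... | false = refl

countV-empty : ∀ {n} → countV (λ (_ : Fin n) → false) ≡ 0
countV-empty {0}     = refl
countV-empty {suc n} = countV-empty {n}

-- Counting respects pointwise inequalities between sums of two indicators.
-- Monotonicity, the union bound and inclusion–exclusion are all instances of
-- this single principle.
count-pointwise : ∀ {n} (f g h k : Fin n → Bool) →
                  (∀ v → ⟦ f v ⟧ + ⟦ g v ⟧ ≤ ⟦ h v ⟧ + ⟦ k v ⟧) →
                  countV f + countV g ≤ countV h + countV k
count-pointwise {0}     f g h k pw = z≤n
count-pointwise {suc n} f g h k pw = begin
    countV f + countV g
  ≡⟨ cong₂ _+_ (countV-suc f) (countV-suc g) ⟩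
    (⟦ f zero ⟧ + countV (tail f)) + (⟦ g zero ⟧ + countV (tail g))
  ≡⟨ interchange +-commutativeSemigroup ⟦ f zero ⟧ _ ⟦ g zero ⟧ _ ⟩
    (⟦ f zero ⟧ + ⟦ g zero ⟧) + (countV (tail f) + countV (tail g))
  ≤⟨ +-mono-≤ (pw zero) (count-pointwise (tail f) (tail g) (tail h) (tail k) (λ v → pw (fsuc v))) ⟩
    (⟦ h zero ⟧ + ⟦ k zero ⟧) + (countV (tail h) + countV (tail k))
  ≡⟨ interchange +-commutativeSemigroup ⟦ h zero ⟧ ⟦ k zero ⟧ _ _ ⟩
    (⟦ h zero ⟧ + countV (tail h)) + (⟦ k zero ⟧ + countV (tail k))
  ≡⟨ sym (cong₂ _+_ (countV-suc h) (countV-suc k)) ⟩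
    countV h + countV k
  ∎
  where
  open ≤-Reasoning
  tail : (Fin (suc n) → Bool) → Fin n → Bool
  tail f i = f (fsuc i)

count-pointwise₁ : ∀ {n} (f h k : Fin n → Bool) →
                   (∀ v → ⟦ f v ⟧ ≤ ⟦ h v ⟧ + ⟦ k v ⟧) →
                   countV f ≤ countV h + countV k
count-pointwise₁ {n} f h k pw =
  subst (_≤ countV h + countV k)
        (trans (cong (countV f +_) (countV-empty {n})) (+-identityʳ _))
        (count-pointwise f (λ _ → false) h k (λ v → subst (_≤ _) (sym (+-identityʳ _)) (pw v)))

count-mono : ∀ {n} (f g : Fin n → Bool) → f ⊆ g → countV f ≤ countV g
count-mono {n} f g f⊆g =
  subst (countV f ≤_)
        (trans (cong (countV g +_) (countV-empty {n})) (+-identityʳ _))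
        (count-pointwise₁ f g (λ _ → false) (λ v → subst (⟦ f v ⟧ ≤_) (sym (+-identityʳ _)) (⟦⟧-mono (f⊆g v))))

count-union : ∀ {n} (f g h : Fin n → Bool) →
              (∀ v → f v ≡ true → g v ≡ true ⊎ h v ≡ true) →
              countV f ≤ countV g + countV h
count-union f g h cover = count-pointwise₁ f g h pw
  where
  pw : ∀ v → ⟦ f v ⟧ ≤ ⟦ g v ⟧ + ⟦ h v ⟧
  pw v with f v in fv
  ... | false = z≤n
  ... | true with cover v fv
  ...   | inj₁ gv rewrite gv = s≤s z≤n
  ...   | inj₂ hv rewrite hv = m≤n+m 1 ⟦ g v ⟧

count-strict : ∀ {n} (f g : Fin n → Bool) → f ⊆ g →
               ∀ w → f w ≡ false → g w ≡ true → suc (countV f) ≤ countV g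
count-strict f g f⊆g zero fw gw rewrite countV-suc f | countV-suc g | fw | gw =
  s≤s (count-mono _ _ (λ v → f⊆g (fsuc v)))
count-strict f g f⊆g (fsuc w) fw gw rewrite countV-suc f | countV-suc g =
  subst (_≤ ⟦ g zero ⟧ + countV (λ i → g (fsuc i))) (+-suc ⟦ f zero ⟧ _)
        (+-mono-≤ (⟦⟧-mono (f⊆g zero)) (count-strict _ _ (λ v → f⊆g (fsuc v)) w fw gw))

count-witness : ∀ {n} (f : Fin n → Bool) → 1 ≤ countV f → ∃ λ w → f w ≡ true
count-witness {0}     f ()
count-witness {suc n} f pos with f zero in f0
... | true  = zero , f0
... | false with count-witness (λ i → f (fsuc i)) pos
...   | w , fw = fsuc w , fw

count-atMostOne : ∀ {n} (f : Fin n → Bool) →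
                  (∀ a b → f a ≡ true → f b ≡ true → a ≡ b) → countV f ≤ 1
count-atMostOne {0}     f unique = z≤n
count-atMostOne {suc n} f unique rewrite countV-suc f with f zero in f0
... | true  = s≤s (subst (countV (λ i → f (fsuc i)) ≤_) (countV-empty {n})
                    (count-mono _ (λ _ → false) (λ i fi → ⊥-elim (0≢1+n (unique zero (fsuc i) f0 fi)))))
... | false = count-atMostOne (λ i → f (fsuc i))
                (λ a b fa fb → suc-injective (unique (fsuc a) (fsuc b) fa fb))

count-complement : ∀ {n} (f : Fin n → Bool) → countV f + countV (λ v → not (f v)) ≡ n
count-complement {0}     f = refl
count-complement {suc n} f = begin
    countV f + countV (λ v → not (f v))
  ≡⟨ cong₂ _+_ (countV-suc f) (countV-suc (λ v → not (f v))) ⟩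
    (⟦ f zero ⟧ + countV (λ i → f (fsuc i))) + (⟦ not (f zero) ⟧ + countV (λ i → not (f (fsuc i))))
  ≡⟨ interchange +-commutativeSemigroup ⟦ f zero ⟧ _ ⟦ not (f zero) ⟧ _ ⟩
    (⟦ f zero ⟧ + ⟦ not (f zero) ⟧) + (countV (λ i → f (fsuc i)) + countV (λ i → not (f (fsuc i))))
  ≡⟨ cong₂ _+_ (indicator-complement (f zero)) (count-complement (λ i → f (fsuc i))) ⟩
    suc n
  ∎
  where
  open ≡-Reasoning
  indicator-complement : ∀ a → ⟦ a ⟧ + ⟦ not a ⟧ ≡ 1
  indicator-complement true  = refl
  indicator-complement false = refl

count≤n : ∀ {n} (f : Fin n → Bool) → countV f ≤ n
count≤n {n} f = subst (countV f ≤_) (count-complement f) (m≤m+n _ _)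

∣∣≡countV : ∀ {n} (Y : Subset n) → ∣ Y ∣ ≡ countV (lookup Y)
∣∣≡countV []           = refl
∣∣≡countV (true  ∷ ys) = cong suc (∣∣≡countV ys)
∣∣≡countV (false ∷ ys) = ∣∣≡countV ys

anyV-intro : ∀ {n} (f : Fin n → Bool) w → f w ≡ true → anyV f ≡ true
anyV-intro f zero     fw = ∨-introˡ fw
anyV-intro f (fsuc w) fw = ∨-introʳ (anyV-intro (λ i → f (fsuc i)) w fw)

anyV-elim : ∀ {n} (f : Fin n → Bool) → anyV f ≡ true → ∃ λ w → f w ≡ true
anyV-elim {0}     f ()
anyV-elim {suc n} f any with ∨-elim {f zero} any
... | inj₁ f0   = zero , f0
... | inj₂ rest with anyV-elim (λ i → f (fsuc i)) rest
...   | w , fw = fsuc w , fw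

∉⇒false : ∀ {n} (Y : Subset n) v → v ∉ Y → lookup Y v ≡ false
∉⇒false Y v v∉Y with lookup Y v in eq
... | true  = ⊥-elim (v∉Y (lookup⇒[]= v Y eq))
... | false = refl

false⇒∉ : ∀ {n} (Y : Subset n) v → lookup Y v ≡ false → v ∉ Y
false⇒∉ Y v eq v∈Y = true≢false ([]=⇒lookup v∈Y) eq

true⇒∈ : ∀ {n} (Y : Subset n) v → lookup Y v ≡ true → v ∈ Y
true⇒∈ Y v = lookup⇒[]= v Y

module Walks {n : ℕ} (G : Graph n) where

  reach-refl : ∀ k u → reachIn k G u u ≡ true
  reach-refl 0       u = ⌊⌋-true (u ≟ u) refl
  reach-refl (suc k) u = ∨-introˡ (reach-refl k u)

  reach-zero : ∀ {u v} → reachIn 0 G u v ≡ true → u ≡ v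
  reach-zero {u} {v} e with u ≟ v
  ... | yes u≡v = u≡v
  reach-zero {u} {v} () | no _

  reach-zero-weaken : ∀ k {u v} → reachIn 0 G u v ≡ true → reachIn k G u v ≡ true
  reach-zero-weaken k e with reach-zero e
  ... | refl = reach-refl k _

  reach-weaken : ∀ k {u v} → reachIn k G u v ≡ true → reachIn (suc k) G u v ≡ true
  reach-weaken k = ∨-introˡ

  reach-step : ∀ k {u w v} → reachIn k G u w ≡ true → G w v ≡ true → reachIn (suc k) G u v ≡ true
  reach-step k {u} {w} {v} uw wv = ∨-introʳ (anyV-intro (λ x → reachIn k G u x ∧ G x v) w (∧-intro uw wv))

  reach-trans : ∀ a b {u w v} → reachIn a G u w ≡ true → reachIn b G w v ≡ true →
                reachIn (b + a) G u v ≡ true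
  reach-trans a 0 uw wv with reach-zero wv
  ... | refl = uw
  reach-trans a (suc b) {u} {w} {v} uw wv with ∨-elim {reachIn b G w v} wv
  ... | inj₁ short = reach-weaken (b + a) (reach-trans a b uw short)
  ... | inj₂ viaX with anyV-elim (λ x → reachIn b G w x ∧ G x v) viaX
  ...   | x , ex = reach-step (b + a) (reach-trans a b uw (∧-elimˡ ex)) (∧-elimʳ ex)

  -- Stabilisation: the set of vertices reachable from u stops growing after at
  -- most n steps (each step either adds a vertex or changes nothing forever),
  -- so connected G u captures reachability by walks of any length.
  module _ (u : Fin n) where

    Closed : ℕ → Set
    Closed k = ∀ m v → reachIn m G u v ≡ true → reachIn k G u v ≡ true

    closed-if-stable : ∀ k → (λ v → reachIn (suc k) G u v) ⊆ (λ v → reachIn k G u v) → Closed k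
    closed-if-stable k stable 0       v e = reach-zero-weaken k e
    closed-if-stable k stable (suc m) v e with ∨-elim {reachIn m G u v} e
    ... | inj₁ short = closed-if-stable k stable m v short
    ... | inj₂ viaW with anyV-elim (λ w → reachIn m G u w ∧ G w v) viaW
    ...   | w , ew = stable v (reach-step k (closed-if-stable k stable m w (∧-elimˡ ew)) (∧-elimʳ ew))

    closed-or-large : ∀ k → Closed k ⊎ suc k ≤ countV (reachIn k G u)
    closed-or-large 0 =
      inj₂ (subst (_≤ countV (reachIn 0 G u)) (cong suc (countV-empty {n}))
                  (count-strict (λ _ → false) (reachIn 0 G u) (λ _ ()) u refl (reach-refl 0 u)))
    closed-or-large (suc k) with closed-or-large k
    ... | inj₁ closed = inj₁ (λ m v e → reach-weaken k (closed m v e))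
    ... | inj₂ large with anyV (λ v → reachIn (suc k) G u v ∧ not (reachIn k G u v)) in new
    ...   | false = inj₁ (λ m v e → reach-weaken k (closed-if-stable k stable m v e))
      where
      stable : (λ v → reachIn (suc k) G u v) ⊆ (λ v → reachIn k G u v)
      stable v e = ¬false⇒true λ old →
        true≢false (anyV-intro (λ v → reachIn (suc k) G u v ∧ not (reachIn k G u v)) v
                               (∧-intro e (not-false old))) new
    ...   | true with anyV-elim (λ v → reachIn (suc k) G u v ∧ not (reachIn k G u v)) new
    ...     | w , ew = inj₂ (≤-trans (s≤s large)
                           (count-strict _ _ (λ v → reach-weaken k) w (not-true (∧-elimʳ ew)) (∧-elimˡ ew)))

    reach⇒connected : ∀ m v → reachIn m G u v ≡ true → connected G u v ≡ true
    reach⇒connected with closed-or-large n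
    ... | inj₁ closed = closed
    ... | inj₂ large  = ⊥-elim (<⇒≱ large (count≤n (reachIn n G u)))

  connected-refl : ∀ u → connected G u u ≡ true
  connected-refl = reach-refl n

  connected-trans : ∀ {u w v} → connected G u w ≡ true → connected G w v ≡ true → connected G u v ≡ true
  connected-trans {u} uw wv = reach⇒connected u (n + n) _ (reach-trans n n uw wv)

  edge⇒connected : ∀ {u v} → G u v ≡ true → connected G u v ≡ true
  edge⇒connected {u} {v} e = reach⇒connected u 1 v (reach-step 0 (reach-refl 0 u) e)

  path₂⇒connected : ∀ {u w v} → G u w ≡ true → G w v ≡ true → connected G u v ≡ true
  path₂⇒connected {u} {w} {v} e₁ e₂ =
    reach⇒connected u 2 v (reach-step 1 (reach-step 0 (reach-refl 0 u) e₁) e₂)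

  module _ (G-sym : ∀ u v → G u v ≡ G v u) where

    reach-sym : ∀ k {u v} → reachIn k G u v ≡ true → reachIn k G v u ≡ true
    reach-sym 0 e with reach-zero e
    ... | refl = reach-refl 0 _
    reach-sym (suc k) {u} {v} e with ∨-elim {reachIn k G u v} e
    ... | inj₁ short = reach-weaken k (reach-sym k short)
    ... | inj₂ viaW with anyV-elim (λ w → reachIn k G u w ∧ G w v) viaW
    ...   | w , ew = subst (λ m → reachIn m G v u ≡ true) (+-comm k 1)
                       (reach-trans 1 k (reach-step 0 (reach-refl 0 v) (trans (G-sym v w) (∧-elimʳ ew)))
                                        (reach-sym k (∧-elimˡ ew)))

    connected-sym : ∀ {u v} → connected G u v ≡ true → connected G v u ≡ true
    connected-sym = reach-sym n

-- Components of G − Y for an undirected graph G.  Every component is represented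
-- by its least vertex (isRepresentative), so components of G − Y are counted by
-- counting representatives.
module Components {n : ℕ} (G : Graph n) (Y : Subset n) (G-sym : ∀ u v → G u v ≡ G v u) where

  deleteV-sym : ∀ u v → deleteV G Y u v ≡ deleteV G Y v u
  deleteV-sym u v with lookup Y u | lookup Y v
  ... | true  | true  = refl
  ... | true  | false = refl
  ... | false | true  = refl
  ... | false | false = G-sym u v

  open Walks (deleteV G Y) public
    using (connected-trans; edge⇒connected; path₂⇒connected)

  Rep : Fin n → Bool
  Rep = isRepresentative G Y

  Conn : Fin n → Fin n → Bool
  Conn = connected (deleteV G Y)

  Conn-sym : ∀ {u v} → Conn u v ≡ true → Conn v u ≡ true
  Conn-sym = Walks.connected-sym (deleteV G Y) deleteV-sym

  Conn-false-sym : ∀ {u v} → Conn u v ≡ false → Conn v u ≡ false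
  Conn-false-sym uv = ¬true⇒false λ vu → true≢false (Conn-sym vu) uv

  separated : ∀ {u a b} → Conn u a ≡ true → Conn u b ≡ false → Conn a b ≡ false
  separated ua ub = ¬true⇒false λ ab → true≢false (connected-trans ua ab) ub

  rep-outside : ∀ {v} → Rep v ≡ true → lookup Y v ≡ false
  rep-outside r = not-true (∧-elimˡ r)

  rep-least : ∀ r w → Rep r ≡ true → toℕ w < toℕ r → inComponent G Y r w ≡ true → ⊥
  rep-least r w rr w<r rw =
    true≢false (anyV-intro (λ x → (toℕ x <ᵇ toℕ r) ∧ inComponent G Y r x) w
                           (∧-intro (Equivalence.to T-≡ (<⇒<ᵇ w<r)) rw))
               (not-true (∧-elimʳ rr))

  rep-unique : ∀ a b → Rep a ≡ true → Rep b ≡ true → Conn a b ≡ true → a ≡ b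
  rep-unique a b ra rb ab with <-cmp (toℕ a) (toℕ b)
  ... | tri≈ _ a≡b _ = toℕ-injective a≡b
  ... | tri< a<b _ _ = ⊥-elim (rep-least b a rb a<b (∧-intro (not-false (rep-outside ra)) (Conn-sym ab)))
  ... | tri> _ _ b<a = ⊥-elim (rep-least a b ra b<a (∧-intro (not-false (rep-outside rb)) ab))

  reps-in-connected-set : (S : Fin n → Bool) →
    (∀ a b → lookup Y a ≡ false → lookup Y b ≡ false → S a ≡ true → S b ≡ true → Conn a b ≡ true) →
    countV (λ v → S v ∧ Rep v) ≤ 1
  reps-in-connected-set S S-connected = count-atMostOne _ λ a b ea eb →
    let ra = ∧-elimʳ {S a} ea ; rb = ∧-elimʳ {S b} eb in
    rep-unique a b ra rb (S-connected a b (rep-outside ra) (rep-outside rb) (∧-elimˡ ea) (∧-elimˡ eb))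

  odd≤reps : oddComponents G Y ≤ countV Rep
  odd≤reps = count-mono _ Rep (λ v e → ∧-elimˡ e)

  reps≤outside : countV Rep ≤ countV (λ v → not (lookup Y v))
  reps≤outside = count-mono Rep _ (λ v r → ∧-elimˡ r)

  -- If the vertices outside Y ∪ Z are pairwise connected in G − Y, then G − Y
  -- has at most 1 + |Z| components: one meeting the complement of Z, plus one
  -- representative per vertex of Z.
  reps-bound : (Z : Fin n → Bool) →
    (∀ a b → lookup Y a ≡ false → lookup Y b ≡ false → Z a ≡ false → Z b ≡ false → Conn a b ≡ true) →
    countV Rep ≤ 1 + countV Z
  reps-bound Z outside-connected =
    ≤-trans (count-union Rep (λ v → not (Z v) ∧ Rep v) Z cover)
            (+-monoˡ-≤ (countV Z) (reps-in-connected-set (λ v → not (Z v))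
              (λ a b ya yb za zb → outside-connected a b ya yb (not-true za) (not-true zb))))
    where
    cover : ∀ v → Rep v ≡ true → not (Z v) ∧ Rep v ≡ true ⊎ Z v ≡ true
    cover v r with true-or-false (Z v)
    ... | inj₁ z = inj₂ z
    ... | inj₂ z = inj₁ (∧-intro (not-false z) r)

  drop-component : (P : Fin n → Bool) (u : Fin n) →
    countV (λ v → P v ∧ Rep v) ≤ 1 + countV (λ v → (P v ∧ not (Conn u v)) ∧ Rep v)
  drop-component P u =
    ≤-trans (count-union _ (λ v → Conn u v ∧ Rep v) _ cover)
            (+-monoˡ-≤ _ (reps-in-connected-set (Conn u)
              (λ a b _ _ ua ub → connected-trans (Conn-sym ua) ub)))
    where
    cover : ∀ v → P v ∧ Rep v ≡ true →
            Conn u v ∧ Rep v ≡ true ⊎ (P v ∧ not (Conn u v)) ∧ Rep v ≡ true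
    cover v e with true-or-false (Conn u v)
    ... | inj₁ uv = inj₁ (∧-intro uv (∧-elimʳ {P v} e))
    ... | inj₂ uv = inj₂ (∧-intro (∧-intro (∧-elimˡ {P v} e) (not-false uv)) (∧-elimʳ {P v} e))

-- Inclusion–exclusion, pointwise: if r and s are disjoint, every element of a
-- avoids r or s, and elements avoiding both are counted twice on the right.
⟦⟧-avoid-disjoint : ∀ a r s → (r ≡ true → s ≡ true → ⊥) →
                    ⟦ a ⟧ + ⟦ a ∧ (not r ∧ not s) ⟧ ≤ ⟦ a ∧ not r ⟧ + ⟦ a ∧ not s ⟧
⟦⟧-avoid-disjoint false r     s     _        = z≤n
⟦⟧-avoid-disjoint true  true  true  disjoint = ⊥-elim (disjoint refl refl)
⟦⟧-avoid-disjoint true  true  false _        = ≤-refl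
⟦⟧-avoid-disjoint true  false true  _        = ≤-refl
⟦⟧-avoid-disjoint true  false false _        = ≤-refl

excess-impossible : ∀ a p → a + p + 2 ≤ 1 + a → ⊥
excess-impossible a p le = m+1+n≰m (suc a) (subst (_≤ suc a) (regroup a p) le)
  where
  regroup : ∀ a p → a + p + 2 ≡ suc a + suc p
  regroup = solve-∀

double-impossible : ∀ {n p} m → n + p ≤ m + m → m + (m + p + 2) ≤ n → ⊥
double-impossible {n} {p} m n+p≤2m 2m+p+2≤n = m+1+n≰m n (begin
    n + suc (suc (p + p))  ≡⟨ regroupˡ n p ⟩
    n + p + (p + 2)        ≤⟨ +-monoˡ-≤ (p + 2) n+p≤2m ⟩
    m + m + (p + 2)        ≡⟨ regroupʳ m p ⟩
    m + (m + p + 2)        ≤⟨ 2m+p+2≤n ⟩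
    n                      ∎)
  where
  open ≤-Reasoning
  regroupˡ : ∀ n p → n + suc (suc (p + p)) ≡ n + p + (p + 2)
  regroupˡ = solve-∀
  regroupʳ : ∀ m p → m + m + (p + 2) ≡ m + (m + p + 2)
  regroupʳ = solve-∀

-- Hence two numbers a, b with 2a + p + 2 ≤ n and 2b + p + 2 ≤ n cannot satisfy
-- n + p ≤ a + b (apply the previous fact to the larger one).
two-small-impossible : ∀ {n p} a b → a + (a + p + 2) ≤ n → b + (b + p + 2) ≤ n → n + p ≤ a + b → ⊥
two-small-impossible a b ha hb n+p≤a+b with ≤-total a b
... | inj₁ a≤b = double-impossible b (≤-trans n+p≤a+b (+-monoˡ-≤ b a≤b)) hb
... | inj₂ b≤a = double-impossible a (≤-trans n+p≤a+b (+-monoʳ-≤ a b≤a)) ha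

colourComplement-sym : ∀ {n t} (c : Fin n → Fin n → Fin t) → (∀ u v → c u v ≡ c v u) →
                       ∀ i u v → colourComplement c i u v ≡ colourComplement c i v u
colourComplement-sym c c-sym i u v rewrite c-sym u v with u ≟ v | v ≟ u
... | yes _   | yes _   = refl
... | no _    | no _    = refl
... | yes u≡v | no v≢u  = ⊥-elim (v≢u (sym u≡v))
... | no u≢v  | yes v≡u = ⊥-elim (u≢v (sym v≡u))

edge-of-complement : ∀ {n t} (c : Fin n → Fin n → Fin t) i (Y : Subset n) {a b} →
                     lookup Y a ≡ false → lookup Y b ≡ false → a ≢ b → c a b ≢ i →
                     deleteV (colourComplement c i) Y a b ≡ true
edge-of-complement c i Y {a} {b} a∉Y b∉Y a≢b ab≢i =
  ∧-intro (not-false a∉Y) (∧-intro (not-false b∉Y)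
    (∧-intro (not-false (⌊⌋-false (a ≟ b) a≢b)) (not-false (⌊⌋-false (c a b ≟ i) ab≢i))))

separated⇒colour : ∀ {n t} (c : Fin n → Fin n → Fin t) i (Y : Subset n) {a b} →
                   lookup Y a ≡ false → lookup Y b ≡ false →
                   connected (deleteV (colourComplement c i) Y) a b ≡ false → a ≢ b × c a b ≡ i
separated⇒colour c i Y {a} {b} a∉Y b∉Y a≁b = a≢b , colour-i
  where
  open Walks (deleteV (colourComplement c i) Y) using (connected-refl; edge⇒connected)
  a≢b : a ≢ b
  a≢b refl = true≢false (connected-refl a) a≁b
  colour-i : c a b ≡ i
  colour-i with c a b ≟ i
  ... | yes ab≡i = ab≡i
  ... | no ab≢i  = ⊥-elim (true≢false (edge⇒connected (edge-of-complement c i Y a∉Y b∉Y a≢b ab≢i)) a≁b)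

-- The setting of Lemma 18, with its hypotheses.  Colour zero plays the role of
-- colour 1 of the paper; x i v says whether v ∈ Xᵢ.
module Lemma18Proof (t′ n p : ℕ) (c : Fin n → Fin n → Fin (2 + t′))
  (c-sym : ∀ u v → c u v ≡ c v u)
  (X : Fin (2 + t′) → Subset n) (mono : ∀ i j → i F.≤ j → ∣ X i ∣ ≤ ∣ X j ∣)
  (hyp : ∀ i → ∣ X i ∣ + p + 2 ≤ oddComponents (colourComplement c i) (X i)) where

  Colour : Set
  Colour = Fin (2 + t′)

  x : Colour → Fin n → Bool
  x i = lookup (X i)

  D : Colour → Graph n
  D i = deleteV (colourComplement c i) (X i)

  module C (i : Colour) = Components (colourComplement c i) (X i) (colourComplement-sym c c-sym i)

  Conn₀ : Fin n → Fin n → Bool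
  Conn₀ = C.Conn zero

  many-reps : ∀ i → ∣ X i ∣ + p + 2 ≤ countV (C.Rep i)
  many-reps i = ≤-trans (hyp i) (C.odd≤reps i)

  -- Those components live outside Xᵢ, so 2|Xᵢ| + p + 2 ≤ n.
  X-small : ∀ i → ∣ X i ∣ + (∣ X i ∣ + p + 2) ≤ n
  X-small i = begin
      ∣ X i ∣ + (∣ X i ∣ + p + 2)
    ≤⟨ +-monoʳ-≤ ∣ X i ∣ (≤-trans (many-reps i) (C.reps≤outside i)) ⟩
      ∣ X i ∣ + countV (λ v → not (x i v))
    ≡⟨ cong (_+ countV (λ v → not (x i v))) (∣∣≡countV (X i)) ⟩
      countV (x i) + countV (λ v → not (x i v))
    ≡⟨ count-complement (x i) ⟩
      n
    ∎
    where open ≤-Reasoning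

  X₀-smallest : ∀ j → countV (x zero) ≤ ∣ X j ∣
  X₀-smallest j = subst (_≤ ∣ X j ∣) (∣∣≡countV (X zero)) (mono zero j z≤n)

  -- An edge between different components of G₀ − X₀ has colour 0, so if its
  -- ends avoid Xⱼ (j ≠ 0) it is an edge of Gⱼ − Xⱼ.
  cross-edge : ∀ j → j ≢ zero → ∀ {a b} → x zero a ≡ false → x zero b ≡ false →
               x j a ≡ false → x j b ≡ false → Conn₀ a b ≡ false → D j a b ≡ true
  cross-edge j j≢0 a₀ b₀ aⱼ bⱼ a≁b with separated⇒colour c zero (X zero) a₀ b₀ a≁b
  ... | a≢b , colour0 = edge-of-complement c j (X j) aⱼ bⱼ a≢b λ ab≡j → j≢0 (trans (sym ab≡j) colour0)

  -- Step (1), forcing: if u ∉ X₀ ∪ Xⱼ (j ≠ 0), every v ∉ X₀ outside the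
  -- component of u lies in Xⱼ.  Otherwise all vertices outside X₀ ∪ Xⱼ are
  -- pairwise connected in Gⱼ − Xⱼ through u or v, leaving at most
  -- 1 + |X₀| ≤ 1 + |Xⱼ| components.
  forced : ∀ j → j ≢ zero → ∀ u → x zero u ≡ false → x j u ≡ false →
           ∀ v → x zero v ≡ false → Conn₀ u v ≡ false → x j v ≡ true
  forced j j≢0 u u₀ uⱼ v v₀ u≁v = ¬false⇒true λ vⱼ →
    excess-impossible ∣ X j ∣ p
      (≤-trans (many-reps j) (≤-trans (C.reps-bound j (x zero) (outside-connected vⱼ))
                                      (s≤s (X₀-smallest j))))
    where
    edge : ∀ {a b} → x zero a ≡ false → x zero b ≡ false →
           x j a ≡ false → x j b ≡ false → Conn₀ a b ≡ false → D j a b ≡ true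
    edge = cross-edge j j≢0
    outside-connected : x j v ≡ false → ∀ a b → x j a ≡ false → x j b ≡ false →
                        x zero a ≡ false → x zero b ≡ false → C.Conn j a b ≡ true
    outside-connected vⱼ a b aⱼ bⱼ a₀ b₀ with true-or-false (Conn₀ u a) | true-or-false (Conn₀ u b)
    ... | inj₁ ua | inj₁ ub = C.path₂⇒connected j
                                (edge a₀ v₀ aⱼ vⱼ (C.separated zero ua u≁v))
                                (edge v₀ b₀ vⱼ bⱼ (C.Conn-false-sym zero (C.separated zero ub u≁v)))
    ... | inj₂ ua | inj₂ ub = C.path₂⇒connected j
                                (edge a₀ u₀ aⱼ uⱼ (C.Conn-false-sym zero ua))
                                (edge u₀ b₀ uⱼ bⱼ ub)
    ... | inj₁ ua | inj₂ ub = C.edge⇒connected j (edge a₀ b₀ aⱼ bⱼ (C.separated zero ua ub))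
    ... | inj₂ ua | inj₁ ub = C.edge⇒connected j
                                (edge a₀ b₀ aⱼ bⱼ (C.Conn-false-sym zero (C.separated zero ub ua)))

  no-crossing : ∀ j k → j ≢ zero → k ≢ zero → ∀ u w →
                x zero u ≡ false → x j u ≡ false → x zero w ≡ false → x k w ≡ false →
                Conn₀ u w ≡ false → ⊥
  no-crossing j k j≢0 k≢0 u w u₀ uⱼ w₀ wₖ u≁w =
    two-small-impossible ∣ X j ∣ ∣ X k ∣ (X-small j) (X-small k) counting
    where
    outside notU notW neither : Fin n → Bool
    outside v = not (x zero v)
    notU    v = outside v ∧ not (Conn₀ u v)
    notW    v = outside v ∧ not (Conn₀ w v)
    neither v = outside v ∧ (not (Conn₀ u v) ∧ not (Conn₀ w v))

    -- All components except those of u and w have their representative in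
    -- neither, and there are at least |X₀| + p + 2 components.
    neither-large : countV (x zero) + p ≤ countV neither
    neither-large = s≤s⁻¹ (s≤s⁻¹ (begin
        2 + (countV (x zero) + p)
      ≡⟨ +-comm 2 _ ⟩
        countV (x zero) + p + 2
      ≡⟨ cong (λ s → s + p + 2) (sym (∣∣≡countV (X zero))) ⟩
        ∣ X zero ∣ + p + 2
      ≤⟨ many-reps zero ⟩
        countV (C.Rep zero)
      ≤⟨ C.drop-component zero (λ _ → true) u ⟩
        1 + countV (λ v → not (Conn₀ u v) ∧ C.Rep zero v)
      ≤⟨ s≤s (C.drop-component zero (λ v → not (Conn₀ u v)) w) ⟩
        2 + countV (λ v → (not (Conn₀ u v) ∧ not (Conn₀ w v)) ∧ C.Rep zero v)
      ≤⟨ s≤s (s≤s (count-mono _ neither λ v e →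
            ∧-intro (not-false (C.rep-outside zero (∧-elimʳ {not (Conn₀ u v) ∧ not (Conn₀ w v)} e)))
                    (∧-elimˡ e))) ⟩
        2 + countV neither
      ∎))
      where open ≤-Reasoning

    -- Each vertex outside X₀ avoids the component of u or that of w.
    covering : countV outside + countV neither ≤ countV notU + countV notW
    covering = count-pointwise outside neither notU notW λ v →
      ⟦⟧-avoid-disjoint (outside v) (Conn₀ u v) (Conn₀ w v)
        λ uv wv → true≢false (C.connected-trans zero uv (C.Conn-sym zero wv)) u≁w

    notU⊆Xⱼ : notU ⊆ x j
    notU⊆Xⱼ v e = forced j j≢0 u u₀ uⱼ v (not-true (∧-elimˡ e)) (not-true (∧-elimʳ e))

    notW⊆Xₖ : notW ⊆ x k
    notW⊆Xₖ v e = forced k k≢0 w w₀ wₖ v (not-true (∧-elimˡ e)) (not-true (∧-elimʳ e))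

    counting : n + p ≤ ∣ X j ∣ + ∣ X k ∣
    counting = begin
        n + p
      ≡⟨ cong (_+ p) (sym (count-complement (x zero))) ⟩
        countV (x zero) + countV outside + p
      ≡⟨ cong (_+ p) (+-comm (countV (x zero)) _) ⟩
        countV outside + countV (x zero) + p
      ≡⟨ +-assoc (countV outside) _ p ⟩
        countV outside + (countV (x zero) + p)
      ≤⟨ +-monoʳ-≤ (countV outside) neither-large ⟩
        countV outside + countV neither
      ≤⟨ covering ⟩
        countV notU + countV notW
      ≤⟨ +-mono-≤ (count-mono notU (x j) notU⊆Xⱼ) (count-mono notW (x k) notW⊆Xₖ) ⟩
        countV (x j) + countV (x k)
      ≡⟨ sym (cong₂ _+_ (∣∣≡countV (X j)) (∣∣≡countV (X k))) ⟩
        ∣ X j ∣ + ∣ X k ∣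
      ∎
      where open ≤-Reasoning

  Conclusion : Fin n → Set
  Conclusion l = l ∉ X zero ×
    (∀ (j : Colour) → j ≢ zero → ∀ v → v ∉ X zero →
       inComponent (colourComplement c zero) (X zero) l v ≡ false → v ∈ X j)

  outside-component : ∀ {l v} → x zero v ≡ false →
                      inComponent (colourComplement c zero) (X zero) l v ≡ false → Conn₀ l v ≡ false
  outside-component v₀ l≁v rewrite v₀ = l≁v

  conclusion-at-missing : ∀ j → j ≢ zero → ∀ u → x zero u ≡ false → x j u ≡ false → Conclusion u
  conclusion-at-missing j j≢0 u u₀ uⱼ = false⇒∉ (X zero) u u₀ , λ k k≢0 v v∉X₀ l≁v →
    let v₀ = ∉⇒false (X zero) v v∉X₀ in
    true⇒∈ (X k) v (¬false⇒true λ vₖ →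
      no-crossing j k j≢0 k≢0 u v u₀ uⱼ v₀ vₖ (outside-component v₀ l≁v))

  conclusion-if-covered : (∀ j → j ≢ zero → ∀ v → x zero v ≡ false → x j v ≡ true) →
                          ∀ l → x zero l ≡ false → Conclusion l
  conclusion-if-covered covered l l₀ = false⇒∉ (X zero) l l₀ , λ j j≢0 v v∉X₀ _ →
    true⇒∈ (X j) v (covered j j≢0 v (∉⇒false (X zero) v v∉X₀))

  outside-vertex : ∃ λ l → x zero l ≡ false
  outside-vertex with count-witness (C.Rep zero) (≤-trans (s≤s z≤n) (≤-trans (m≤n+m 2 _) (many-reps zero)))
  ... | l , rep = l , C.rep-outside zero rep

  Missing : Set
  Missing = ∃ λ (j : Colour) → j ≢ zero × ∃ λ u → x zero u ≡ false × x j u ≡ false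

  missing? : Dec Missing
  missing? = any? λ j → ¬? (j ≟ zero) ×-dec any? λ u → (x zero u ≟ᵇ false) ×-dec (x j u ≟ᵇ false)

lemma18 : (t′ n p : ℕ)
          (c : Fin n → Fin n → Fin (2 + t′)) →
          (∀ u v → c u v ≡ c v u) →
          (X : Fin (2 + t′) → Subset n) →
          (∀ i j → i F.≤ j → ∣ X i ∣ ≤ ∣ X j ∣) →
          (∀ i → ∣ X i ∣ + p + 2 ≤ oddComponents (colourComplement c i) (X i)) →
          Σ (Fin n) (λ l → l ∉ X zero ×
            (∀ (j : Fin (2 + t′)) → j ≢ zero → ∀ v → v ∉ X zero →
               inComponent (colourComplement c zero) (X zero) l v ≡ false →
               v ∈ X j))
lemma18 t′ n p c c-sym X mono hyp = conclude missing?
  where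
  open Lemma18Proof t′ n p c c-sym X mono hyp
  conclude : Dec Missing → Σ (Fin n) Conclusion
  conclude (yes (j , j≢0 , u , u₀ , uⱼ)) = u , conclusion-at-missing j j≢0 u u₀ uⱼ
  conclude (no none) = let (l , l₀) = outside-vertex in
    l , conclusion-if-covered (λ j j≢0 v v₀ → ¬false⇒true λ vⱼ → none (j , j≢0 , v , v₀ , vⱼ)) l l₀
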